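{- Let $c\ge 2$ be an integer. Let $G$ be an orderable group and let $S$ be a finite subset of $G$ such that $\langle S\rangle$ is abelian. If $$|S^2|<(c+1)|S|-\frac{c(c+1)}{2},$$ then $\langle S\rangle$ is generated by a set of at most $c$ elements.
   Context: A group $G$ is orderable if there is a total order $\le$ on $G$ such that $a\le b$ implies $xay\le xby$ for all $a,b,x,y\in G$. For a subset $S$ of a group, $S^2=\{x_1x_2 : x_1,x_2\in S\}$, and $\langle S\rangle$ is the subgroup generated by $S$. -}

module Defs where

open import Level using (Level; _⊔_; suc)
open import Data.Nat using (ℕ)
open import Data.List using (List; length)
open import Data.Product using (Σ; ∃; _×_; _,_)
open import Algebra.Bundles using (Group)
open import Relation.Binary.Structures using (IsTotalOrder)
open import Relation.Binary.Core using (Rel)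
import Data.List.Membership.Setoid as SetoidMembership
import Data.List.Relation.Unary.Unique.Setoid as SetoidUnique

module _ {a ℓ : Level} (G : Group a ℓ) where
  open Group G

  _∈ₛ_ : Carrier → List Carrier → Set (a ⊔ ℓ)
  x ∈ₛ xs = SetoidMembership._∈_ setoid x xs

  Uniqueₛ : List Carrier → Set (a ⊔ ℓ)
  Uniqueₛ = SetoidUnique.Unique setoid

  record IsOrdering {ℓ₂ : Level} (_≤_ : Rel Carrier ℓ₂) : Set (a ⊔ ℓ ⊔ ℓ₂) where
    field
      isTotalOrder : IsTotalOrder _≈_ _≤_
      compatible   : ∀ {p q} (x y : Carrier) → p ≤ q → ((x ∙ p) ∙ y) ≤ ((x ∙ q) ∙ y)

  Orderable : (ℓ₂ : Level) → Set (a ⊔ ℓ ⊔ suc ℓ₂)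
  Orderable ℓ₂ = Σ (Rel Carrier ℓ₂) IsOrdering

  data ⟨_⟩ (T : List Carrier) : Carrier → Set (a ⊔ ℓ) where
    gen  : ∀ {x} → x ∈ₛ T → ⟨ T ⟩ x
    unit : ⟨ T ⟩ ε
    mul  : ∀ {x y} → ⟨ T ⟩ x → ⟨ T ⟩ y → ⟨ T ⟩ (x ∙ y)
    inv  : ∀ {x} → ⟨ T ⟩ x → ⟨ T ⟩ (x ⁻¹)
    resp : ∀ {x y} → x ≈ y → ⟨ T ⟩ x → ⟨ T ⟩ y

  GeneratedAbelian : List Carrier → Set (a ⊔ ℓ)
  GeneratedAbelian S = ∀ x y → ⟨ S ⟩ x → ⟨ S ⟩ y → (x ∙ y) ≈ (y ∙ x)

  EnumeratesSquare : List Carrier → List Carrier → Set (a ⊔ ℓ)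
  EnumeratesSquare S P =
    Uniqueₛ P ×
    (∀ z → z ∈ₛ P → ∃ λ x₁ → ∃ λ x₂ → x₁ ∈ₛ S × x₂ ∈ₛ S × z ≈ (x₁ ∙ x₂)) ×
    (∀ x₁ x₂ → x₁ ∈ₛ S → x₂ ∈ₛ S → (x₁ ∙ x₂) ∈ₛ P)

  SameSubgroup : List Carrier → List Carrier → Set (a ⊔ ℓ)
  SameSubgroup S T = (∀ x → ⟨ S ⟩ x → ⟨ T ⟩ x) × (∀ x → ⟨ T ⟩ x → ⟨ S ⟩ x)

-- Add the elements of S one at a time, from the smallest up, so that each new element m is
-- the maximum of S′ ∪ {m}. The products m y that do not already lie in S′² are new elements
-- of S²; let B be the set of such y. If no product m y lies in S′², then m brings |S′| + 1
-- new products and costs one new generator. Otherwise m ∈ ⟨S′⟩, and B alone generates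
-- ⟨S′ ∪ {m}⟩: if y ∉ B then m y = a b with a, b ∈ S′, and since the order is compatible and
-- y commutes with m this forces y < a, y < b < m, so y = m⁻¹ a b is reached by induction
-- downwards. Keeping the smaller of the two generating sets, a set S generated by d of its
-- elements satisfies |S²| ≥ Σ_{i ≤ |S|} min(d, i), and for d > c this sum is at least
-- (c + 1)|S| − c(c + 1)/2.
module Submission where

open import Defs
open import Level using (Level; _⊔_)
open import Data.Nat using (ℕ; zero; suc; _≤_; _<_; _+_; _*_; _⊓_; z≤n; s≤s)
open import Data.Nat.Properties
  using ( ≤-refl; ≤-trans; ≤-reflexive; ≮⇒≥; <⇒≱; ≰⇒≥; _≤?_; module ≤-Reasoning
        ; +-comm; *-comm; +-identityʳ; *-identityʳ; ⊓-zeroʳ; m⊓n≤m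
        ; +-mono-≤; +-monoˡ-≤; +-monoʳ-≤; *-monoʳ-≤; ⊓-monoˡ-≤ )
open import Data.Nat.Tactic.RingSolver using (solve-∀)
open import Data.List using (List; []; _∷_; length; map; _++_)
open import Data.List.Properties using (length-++; length-map; length-removeAt′)
open import Data.List.Relation.Unary.All as All using (All; []; _∷_)
import Data.List.Relation.Unary.All.Properties as All
open import Data.List.Relation.Unary.Any as Any using (Any; here; there; index)
open import Data.List.Relation.Unary.AllPairs as AllPairs using (AllPairs; []; _∷_)
open import Data.Product using (∃; ∃₂; _×_; _,_)
open import Data.Sum using (_⊎_; inj₁; inj₂; map₂)
open import Data.Empty using (⊥-elim)
open import Function using (_∘_; id; flip)
open import Algebra.Bundles using (Group)
open import Relation.Binary.Bundles using (Setoid; TotalOrder)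
open import Relation.Binary.Core using (Rel)
open import Relation.Binary.Definitions using (_Respects_)
open import Relation.Binary.PropositionalEquality as ≡ using (_≡_; module ≡-Reasoning)
open import Relation.Nullary using (¬_; Dec; yes; no)
open import Relation.Nullary.Decidable using (_⊎-dec_; map′)
open import Relation.Unary using (Pred)
import Algebra.Properties.Group as GroupProperties
import Data.List.Membership.Setoid as Membership
import Data.List.Membership.Setoid.Properties as MembershipProperties
import Data.List.Relation.Unary.Unique.Setoid as UniqueSetoid
import Data.List.Relation.Unary.Unique.Setoid.Properties as Unique
import Data.List.Relation.Binary.Permutation.Setoid as Permutation
import Data.List.Relation.Binary.Permutation.Setoid.Properties as PermutationProperties
import Relation.Binary.Properties.TotalOrder as TotalOrderProperties
import Relation.Binary.Reasoning.PartialOrder as PartialOrderReasoning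

private
  variable
    a p r ℓ ℓ₂ : Level

minSum : ℕ → ℕ → ℕ
minSum zero    t = 0
minSum (suc n) t = t ⊓ suc n + minSum n t

minSum-monoʳ-≤ : ∀ n {t t′} → t ≤ t′ → minSum n t ≤ minSum n t′
minSum-monoʳ-≤ zero    t≤t′ = z≤n
minSum-monoʳ-≤ (suc n) t≤t′ = +-mono-≤ (⊓-monoˡ-≤ (suc n) t≤t′) (minSum-monoʳ-≤ n t≤t′)

minSum-one : ∀ n → minSum n 1 ≡ n
minSum-one zero    = ≡.refl
minSum-one (suc n) = ≡.cong suc (minSum-one n)

minSum-suc-suc : ∀ n t → minSum (suc n) (suc t) ≡ suc n + minSum n t
minSum-suc-suc zero    t = ≡.cong (λ s → suc (s + 0)) (⊓-zeroʳ t)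
minSum-suc-suc (suc n) t = begin
  suc (t ⊓ suc n) + minSum (suc n) (suc t) ≡⟨ ≡.cong (suc (t ⊓ suc n) +_) (minSum-suc-suc n t) ⟩
  suc (t ⊓ suc n) + (suc n + minSum n t)   ≡⟨ exchange (t ⊓ suc n) n (minSum n t) ⟩
  suc (suc n) + (t ⊓ suc n + minSum n t)   ∎
  where
  open ≡-Reasoning
  exchange : ∀ x m y → suc x + (suc m + y) ≡ suc (suc m) + (x + y)
  exchange = solve-∀

minSum-step-≤ : ∀ n {s t b} → s ≤ t → s ≤ b → minSum (suc n) s ≤ b + minSum n t
minSum-step-≤ n s≤t s≤b = +-mono-≤ (≤-trans (m⊓n≤m _ _) s≤b) (minSum-monoʳ-≤ n s≤t)

minSum-lowerBound : ∀ k c → 2 * (k * suc c) ≤ 2 * minSum k (suc c) + c * suc c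
minSum-lowerBound zero    c       = z≤n
minSum-lowerBound (suc k) zero    = ≤-reflexive (begin
  2 * (suc k * 1)          ≡⟨ ≡.cong (2 *_) (*-identityʳ (suc k)) ⟩
  2 * suc k                ≡⟨ ≡.cong (2 *_) (≡.sym (minSum-one (suc k))) ⟩
  2 * minSum (suc k) 1     ≡⟨ ≡.sym (+-identityʳ _) ⟩
  2 * minSum (suc k) 1 + 0 ∎)
  where open ≡-Reasoning
minSum-lowerBound (suc k) (suc c) = begin
  2 * (suc k * suc (suc c))                                  ≡⟨ expandˡ k c ⟩
  2 * (k * suc c) + (2 * suc k + 2 * suc c)                  ≤⟨ +-monoˡ-≤ _ (minSum-lowerBound k c) ⟩
  2 * minSum k (suc c) + c * suc c + (2 * suc k + 2 * suc c) ≡⟨ expandʳ k c (minSum k (suc c)) ⟩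
  2 * (suc k + minSum k (suc c)) + suc c * suc (suc c)       ≡⟨ ≡.cong (λ s → 2 * s + suc c * suc (suc c))
                                                                       (≡.sym (minSum-suc-suc k (suc c))) ⟩
  2 * minSum (suc k) (suc (suc c)) + suc c * suc (suc c)     ∎
  where
  open ≤-Reasoning
  expandˡ : ∀ k c → 2 * (suc k * suc (suc c)) ≡ 2 * (k * suc c) + (2 * suc k + 2 * suc c)
  expandˡ = solve-∀
  expandʳ : ∀ k c s → 2 * s + c * suc c + (2 * suc k + 2 * suc c) ≡ 2 * (suc k + s) + suc c * suc (suc c)
  expandʳ = solve-∀

minSum≤⇒≤ : ∀ {k t p} c → minSum k t ≤ p → 2 * p + c * (c + 1) < 2 * ((c + 1) * k) → t ≤ c
minSum≤⇒≤ {k} {t} {p} c minSum≤p p-small = ≮⇒≥ λ c<t → <⇒≱ p-small (begin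
  2 * ((c + 1) * k)                ≡⟨ ≡.cong (λ d → 2 * (d * k)) (+-comm c 1) ⟩
  2 * (suc c * k)                  ≡⟨ ≡.cong (2 *_) (*-comm (suc c) k) ⟩
  2 * (k * suc c)                  ≤⟨ minSum-lowerBound k c ⟩
  2 * minSum k (suc c) + c * suc c ≤⟨ +-monoˡ-≤ _ (*-monoʳ-≤ 2 (≤-trans (minSum-monoʳ-≤ k c<t) minSum≤p)) ⟩
  2 * p + c * suc c                ≡⟨ ≡.cong (λ d → 2 * p + c * d) (+-comm 1 c) ⟩
  2 * p + c * (c + 1)              ∎)
  where open ≤-Reasoning

-- stdlib's filter needs a globally decidable predicate; here R is only decidable on the list.
module _ {A : Set a} {R : Pred A r} where

  any?-All : ∀ {xs} → All (λ x → Dec (R x)) xs → Dec (Any R xs)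
  any?-All []       = no λ ()
  any?-All (d ∷ ds) = map′ Any.fromSum Any.toSum (d ⊎-dec any?-All ds)

  reject : ∀ {xs} → All (λ x → Dec (R x)) xs → List A
  reject {[]}     []           = []
  reject {x ∷ xs} (yes _ ∷ ds) = reject ds
  reject {x ∷ xs} (no _  ∷ ds) = x ∷ reject ds

  reject-All : ∀ {P : Pred A p} {xs} (ds : All (λ x → Dec (R x)) xs) → All P xs → All P (reject ds)
  reject-All []           []         = []
  reject-All (yes _ ∷ ds) (_  ∷ pxs) = reject-All ds pxs
  reject-All (no _  ∷ ds) (px ∷ pxs) = px ∷ reject-All ds pxs

  reject-AllPairs : ∀ {Q : A → A → Set p} {xs} (ds : All (λ x → Dec (R x)) xs) →
                    AllPairs Q xs → AllPairs Q (reject ds)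
  reject-AllPairs []           []         = []
  reject-AllPairs (yes _ ∷ ds) (_  ∷ qxs) = reject-AllPairs ds qxs
  reject-AllPairs (no _  ∷ ds) (qx ∷ qxs) = reject-All ds qx ∷ reject-AllPairs ds qxs

  reject-¬ : ∀ {xs} (ds : All (λ x → Dec (R x)) xs) → All (λ x → ¬ R x) (reject ds)
  reject-¬ []            = []
  reject-¬ (yes _  ∷ ds) = reject-¬ ds
  reject-¬ (no ¬rx ∷ ds) = ¬rx ∷ reject-¬ ds

  length-reject : ∀ {xs} (ds : All (λ x → Dec (R x)) xs) → length (reject ds) ≡ length xs ⊎ Any R xs
  length-reject []            = inj₁ ≡.refl
  length-reject (yes rx ∷ ds) = inj₂ (here rx)
  length-reject (no _   ∷ ds) with length-reject ds
  ... | inj₁ |ds|≡|xs| = inj₁ (≡.cong suc |ds|≡|xs|)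
  ... | inj₂ any       = inj₂ (there any)

module _ (S : Setoid a ℓ) where
  open Setoid S
  open Membership S using (_∈_; _─_)
  open UniqueSetoid S using (Unique)

  reject-∈⊎ : ∀ {R : Pred Carrier r} {xs} (ds : All (λ x → Dec (R x)) xs) →
              All (λ x → R x ⊎ x ∈ reject ds) xs
  reject-∈⊎ []            = []
  reject-∈⊎ (yes rx ∷ ds) = inj₁ rx ∷ reject-∈⊎ ds
  reject-∈⊎ (no _   ∷ ds) = inj₂ (here refl) ∷ All.map (map₂ there) (reject-∈⊎ ds)

  ∈-─ : ∀ {x y xs} (x∈xs : x ∈ xs) → y ∈ xs → ¬ y ≈ x → y ∈ xs ─ x∈xs
  ∈-─ (here x≈z) (here y≈z) y≉x = ⊥-elim (y≉x (trans y≈z (sym x≈z)))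
  ∈-─ (here _)   (there y∈) _   = y∈
  ∈-─ (there _)  (here y≈z) _   = here y≈z
  ∈-─ (there x∈) (there y∈) y≉x = there (∈-─ x∈ y∈ y≉x)

  unique-⊆⇒length-≤ : ∀ {xs ys} → Unique xs → All (_∈ ys) xs → length xs ≤ length ys
  unique-⊆⇒length-≤ {[]}         []           []             = z≤n
  unique-⊆⇒length-≤ {x ∷ xs} {ys} (x≉xs ∷ xs!) (x∈ys ∷ xs⊆ys) = begin
    suc (length xs)          ≤⟨ s≤s (unique-⊆⇒length-≤ xs! (All.zipWith still-in (x≉xs , xs⊆ys))) ⟩
    suc (length (ys ─ x∈ys)) ≡⟨ ≡.sym (length-removeAt′ ys (index x∈ys)) ⟩
    length ys                ∎
    where
    open ≤-Reasoning
    still-in : ∀ {y} → ¬ x ≈ y × y ∈ ys → y ∈ ys ─ x∈ys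
    still-in (x≉y , y∈ys) = ∈-─ x∈ys y∈ys (x≉y ∘ sym)

  unique⇒≈-dec : ∀ {x y xs} → Unique xs → x ∈ xs → y ∈ xs → Dec (x ≈ y)
  unique⇒≈-dec _       (here x≈z) (here y≈z) = yes (trans x≈z (sym y≈z))
  unique⇒≈-dec xs!     (here x≈z) (there y∈) = no λ x≈y →
    Unique.Unique[x∷xs]⇒x∉xs S xs! (MembershipProperties.∈-resp-≈ S (trans (sym x≈y) x≈z) y∈)
  unique⇒≈-dec xs!     (there x∈) (here y≈z) = no λ x≈y →
    Unique.Unique[x∷xs]⇒x∉xs S xs! (MembershipProperties.∈-resp-≈ S (trans x≈y y≈z) x∈)
  unique⇒≈-dec (_ ∷ xs!) (there x∈) (there y∈) = unique⇒≈-dec xs! x∈ y∈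

module Sorting (O : TotalOrder a ℓ ℓ₂) where
  open TotalOrder O using (Carrier; _≈_; module Eq; total) renaming (_≤_ to _≼_)
  open TotalOrderProperties O using (<-respˡ-≈; <-asym; <-irrefl; <-trans; <⇒≉; ≤∧≉⇒<)
    renaming (_<_ to _≺_)
  open Membership Eq.setoid using (_∈_)
  open UniqueSetoid Eq.setoid using (Unique)
  open Permutation Eq.setoid using (_↭_; ↭-refl; ↭-prep; ↭-swap; ↭-trans; ↭-sym)
  open PermutationProperties Eq.setoid using (All-resp-↭)

  Descending : List Carrier → Set (a ⊔ ℓ ⊔ ℓ₂)
  Descending = AllPairs (flip _≺_)

  descending⇒unique : ∀ {xs} → Descending xs → Unique xs
  descending⇒unique = AllPairs.map (λ y≺x x≈y → <⇒≉ y≺x (Eq.sym x≈y))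

  insert : Carrier → List Carrier → List Carrier
  insert x []       = x ∷ []
  insert x (y ∷ ys) with total y x
  ... | inj₁ _ = x ∷ y ∷ ys
  ... | inj₂ _ = y ∷ insert x ys

  sort : List Carrier → List Carrier
  sort []       = []
  sort (x ∷ xs) = insert x (sort xs)

  insert-↭ : ∀ x ys → insert x ys ↭ x ∷ ys
  insert-↭ x []       = ↭-refl
  insert-↭ x (y ∷ ys) with total y x
  ... | inj₁ _ = ↭-refl
  ... | inj₂ _ = ↭-trans (↭-prep y (insert-↭ x ys)) (↭-swap y x ↭-refl)

  sort-↭ : ∀ xs → sort xs ↭ xs
  sort-↭ []       = ↭-refl
  sort-↭ (x ∷ xs) = ↭-trans (insert-↭ x (sort xs)) (↭-prep x (sort-↭ xs))

  insert-descending : ∀ {x ys} → All (λ y → ¬ x ≈ y) ys → Descending ys → Descending (insert x ys)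
  insert-descending {x} {[]}     []           []           = [] ∷ []
  insert-descending {x} {y ∷ ys} (x≉y ∷ x≉ys) (y≺ys ∷ desc) with total y x
  ... | inj₁ y≼x = (y≺x ∷ All.map (λ z≺y → <-trans z≺y y≺x) y≺ys) ∷ y≺ys ∷ desc
    where y≺x = ≤∧≉⇒< y≼x (x≉y ∘ Eq.sym)
  ... | inj₂ x≼y = All-resp-↭ <-respˡ-≈ (↭-sym (insert-↭ x ys)) (≤∧≉⇒< x≼y x≉y ∷ y≺ys)
                 ∷ insert-descending x≉ys desc

  sort-descending : ∀ {xs} → Unique xs → Descending (sort xs)
  sort-descending {[]}     []           = []
  sort-descending {x ∷ xs} (x≉xs ∷ xs!) =
    insert-descending (All-resp-↭ ≉-respʳ (↭-sym (sort-↭ xs)) x≉xs) (sort-descending xs!)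
    where
    ≉-respʳ : (λ y → ¬ x ≈ y) Respects _≈_
    ≉-respʳ y≈z x≉y x≈z = x≉y (Eq.trans x≈z (Eq.sym y≈z))

  descending-induction : ∀ {P : Pred Carrier p} → P Respects _≈_ → ∀ {xs} → Descending xs →
                         All (λ y → (∀ {z} → z ∈ xs → y ≺ z → P z) → P y) xs → All P xs
  descending-induction P-resp {[]}     []            []             = []
  descending-induction {P = P} P-resp {x ∷ xs} (x≻xs ∷ desc) (step ∷ steps) =
    px ∷ descending-induction P-resp desc (All.map lower steps)
    where
    px : P x
    px = step λ { (here z≈x) x≺z → ⊥-elim (<-irrefl (Eq.sym z≈x) x≺z)
                ; (there z∈) x≺z → ⊥-elim (<-asym x≺z (All.lookupₛ Eq.setoid <-respˡ-≈ x≻xs z∈)) }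
    lower : ∀ {y} → ((∀ {z} → z ∈ x ∷ xs → y ≺ z → P z) → P y) →
            (∀ {z} → z ∈ xs → y ≺ z → P z) → P y
    lower step-y above = step-y λ { (here z≈x) _   → P-resp (Eq.sym z≈x) px
                                  ; (there z∈) y≺z → above z∈ y≺z }

module Squares (G : Group a ℓ) where
  open Group G
  open GroupProperties G using (x≈z//y)
  open Membership setoid using (_∈_; find; lose)
  open UniqueSetoid setoid using (Unique)
  open Permutation setoid using (_↭_)
  open PermutationProperties setoid using (∈-resp-↭)

  ⟨⟩-least : ∀ {A B} → All (⟨_⟩ G B) A → ∀ {y} → ⟨_⟩ G A y → ⟨_⟩ G B y
  ⟨⟩-least A⊆⟨B⟩ (gen y∈A)  = All.lookupₛ setoid resp A⊆⟨B⟩ y∈A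
  ⟨⟩-least A⊆⟨B⟩ unit       = unit
  ⟨⟩-least A⊆⟨B⟩ (mul p q)  = mul (⟨⟩-least A⊆⟨B⟩ p) (⟨⟩-least A⊆⟨B⟩ q)
  ⟨⟩-least A⊆⟨B⟩ (inv p)    = inv (⟨⟩-least A⊆⟨B⟩ p)
  ⟨⟩-least A⊆⟨B⟩ (resp e p) = resp e (⟨⟩-least A⊆⟨B⟩ p)

  ⟨⟩-∷ : ∀ {x A y} → ⟨_⟩ G A y → ⟨_⟩ G (x ∷ A) y
  ⟨⟩-∷ = ⟨⟩-least (All.tabulateₛ setoid (gen ∘ there))

  infix 4 _∈²_
  _∈²_ : Carrier → List Carrier → Set (a ⊔ ℓ)
  z ∈² xs = Any (λ x → Any (λ y → z ≈ x ∙ y) xs) xs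

  ∈²-resp-≈ : ∀ {xs} → (_∈² xs) Respects _≈_
  ∈²-resp-≈ z≈w = Any.map (Any.map (trans (sym z≈w)))

  ∈²⁺ : ∀ {xs x y z} → x ∈ xs → y ∈ xs → z ≈ x ∙ y → z ∈² xs
  ∈²⁺ x∈ y∈ z≈xy =
    lose (λ x≈x′ → Any.map (λ z≈ → trans z≈ (∙-congʳ x≈x′)))
         x∈ (lose (λ y≈y′ z≈ → trans z≈ (∙-congˡ y≈y′)) y∈ z≈xy)

  ∈²⁻ : ∀ {xs z} → z ∈² xs → ∃₂ λ x y → x ∈ xs × y ∈ xs × z ≈ x ∙ y
  ∈²⁻ z∈² =
    let x , x∈ , z∈x· = find z∈²; y , y∈ , z≈xy = find z∈x·
    in x , y , x∈ , y∈ , z≈xy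

  ∈²-∷ : ∀ {x xs z} → z ∈² xs → z ∈² x ∷ xs
  ∈²-∷ = there ∘ Any.map there

  ∈²-resp-↭ : ∀ {z} → (z ∈²_) Respects _↭_
  ∈²-resp-↭ xs↭ys z∈² =
    let x , y , x∈ , y∈ , z≈xy = ∈²⁻ z∈²
    in ∈²⁺ (∈-resp-↭ xs↭ys x∈) (∈-resp-↭ xs↭ys y∈) z≈xy

  ∙∈²⇒∈⟨⟩ : ∀ {m xs} → Any (λ y → m ∙ y ∈² xs) xs → ⟨_⟩ G xs m
  ∙∈²⇒∈⟨⟩ {m} my∈² =
    let y , y∈ , my∈²′ = find my∈²; x , x′ , x∈ , x′∈ , my≈xx′ = ∈²⁻ my∈²′
    in resp (sym (x≈z//y m y (x ∙ x′) my≈xx′)) (mul (mul (gen x∈) (gen x′∈)) (inv (gen y∈)))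

  record Generation (S : List Carrier) : Set (a ⊔ ℓ) where
    field
      gens            : List Carrier
      gens⊆S          : All (_∈ S) gens
      S⊆⟨gens⟩        : All (⟨_⟩ G gens) S
      square          : List Carrier
      square-unique   : Unique square
      square⊆S²       : All (_∈² S) square
      minSum≤|square| : minSum (length S) (length gens) ≤ length square

module OrderedGroup (G : Group a ℓ) {_≼_ : Rel (Group.Carrier G) ℓ₂} (ord : IsOrdering G _≼_) where
  open Group G
  open IsOrdering ord
  open GroupProperties G using (∙-cancelˡ; ∙-cancelʳ)

  totalOrder : TotalOrder a ℓ ℓ₂
  totalOrder = record { isTotalOrder = isTotalOrder }

  open TotalOrderProperties totalOrder using (<-irrefl; ≰⇒>) renaming (_<_ to _≺_)
  open PartialOrderReasoning (TotalOrder.poset totalOrder)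

  ∙-monoˡ-≼ : ∀ z {x y} → x ≼ y → (x ∙ z) ≼ (y ∙ z)
  ∙-monoˡ-≼ z {x} {y} x≼y = begin
    x ∙ z         ≈⟨ ∙-congʳ (sym (identityˡ x)) ⟩
    (ε ∙ x) ∙ z   ≤⟨ compatible ε z x≼y ⟩
    (ε ∙ y) ∙ z   ≈⟨ ∙-congʳ (identityˡ y) ⟩
    y ∙ z         ∎

  ∙-monoʳ-≼ : ∀ z {x y} → x ≼ y → (z ∙ x) ≼ (z ∙ y)
  ∙-monoʳ-≼ z {x} {y} x≼y = begin
    z ∙ x         ≈⟨ sym (identityʳ (z ∙ x)) ⟩
    (z ∙ x) ∙ ε   ≤⟨ compatible z ε x≼y ⟩
    (z ∙ y) ∙ ε   ≈⟨ identityʳ (z ∙ y) ⟩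
    z ∙ y         ∎

  ∙-monoˡ-≺ : ∀ z {x y} → x ≺ y → x ∙ z ≺ y ∙ z
  ∙-monoˡ-≺ z (x≼y , x≉y) = ∙-monoˡ-≼ z x≼y , λ xz≈yz → x≉y (∙-cancelʳ z _ _ xz≈yz)

  ∙-monoʳ-≺ : ∀ z {x y} → x ≺ y → z ∙ x ≺ z ∙ y
  ∙-monoʳ-≺ z (x≼y , x≉y) = ∙-monoʳ-≼ z x≼y , λ zx≈zy → x≉y (∙-cancelˡ z _ _ zx≈zy)

  ∙-mono-≺ : ∀ {x y u v} → x ≺ y → u ≺ v → x ∙ u ≺ y ∙ v
  ∙-mono-≺ {x} {y} {u} {v} x≺y u≺v = begin-strict
    x ∙ u   <⟨ ∙-monoˡ-≺ u x≺y ⟩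
    y ∙ u   <⟨ ∙-monoʳ-≺ y u≺v ⟩
    y ∙ v   ∎

  factor-≺ˡ : ∀ {x y u v} → x ∙ y ≈ u ∙ v → u ≺ x → y ≺ v
  factor-≺ˡ {x} {y} {u} {v} xy≈uv u≺x = ≰⇒> λ v≼y → <-irrefl (sym xy≈uv) (begin-strict
    u ∙ v   <⟨ ∙-monoˡ-≺ v u≺x ⟩
    x ∙ v   ≤⟨ ∙-monoʳ-≼ x v≼y ⟩
    x ∙ y   ∎)

  factor-≺ʳ : ∀ {x y u v} → x ∙ y ≈ u ∙ v → v ≺ y → x ≺ u
  factor-≺ʳ {x} {y} {u} {v} xy≈uv v≺y = ≰⇒> λ u≼x → <-irrefl (sym xy≈uv) (begin-strict
    u ∙ v   <⟨ ∙-monoʳ-≺ u v≺y ⟩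
    u ∙ y   ≤⟨ ∙-monoˡ-≼ y u≼x ⟩
    x ∙ y   ∎)

module Generations (G : Group a ℓ) {_≼_ : Rel (Group.Carrier G) ℓ₂} (ord : IsOrdering G _≼_) where
  open Group G
  open GroupProperties G using (∙-cancelˡ; y≈x\\z)
  open Membership setoid using (_∈_)
  open UniqueSetoid setoid using (Unique)
  open MembershipProperties using (∈-map⁻)
  open Permutation setoid using (_↭_)
  open PermutationProperties setoid using (∈-resp-↭; All-resp-↭; xs↭ys⇒|xs|≡|ys|)
  open Squares G
  open OrderedGroup G ord
  open Sorting totalOrder
    using (Descending; descending⇒unique; descending-induction; sort; sort-↭; sort-descending)
  open TotalOrderProperties totalOrder using (<-irrefl; <-trans; <-respˡ-≈) renaming (_<_ to _≺_)

  ≺-lookup : ∀ {m xs} → All (_≺ m) xs → ∀ {x} → x ∈ xs → x ≺ m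
  ≺-lookup = All.lookupₛ setoid <-respˡ-≈

  ∙-self-∉² : ∀ {m xs} → All (_≺ m) xs → ¬ m ∙ m ∈² xs
  ∙-self-∉² m≻xs mm∈² =
    let a , b , a∈ , b∈ , mm≈ab = ∈²⁻ mm∈²
    in <-irrefl (sym mm≈ab) (∙-mono-≺ (≺-lookup m≻xs a∈) (≺-lookup m≻xs b∈))

  -- Decidable equality of products is what makes the set of new products computable.
  module _ (S₀ : List Carrier)
           (S₀-comm : ∀ {x y} → x ∈ S₀ → y ∈ S₀ → x ∙ y ≈ y ∙ x)
           (S₀-∙-≟ : ∀ {x y u v} → x ∈ S₀ → y ∈ S₀ → u ∈ S₀ → v ∈ S₀ → Dec (x ∙ y ≈ u ∙ v))
           where

    ∈²? : ∀ {x y xs} → x ∈ S₀ → y ∈ S₀ → All (_∈ S₀) xs → Dec (x ∙ y ∈² xs)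
    ∈²? x∈ y∈ xs⊆S₀ =
      any?-All (All.map (λ u∈ → any?-All (All.map (S₀-∙-≟ x∈ y∈ u∈) xs⊆S₀)) xs⊆S₀)

    spanned-by-new : ∀ {m S′ B} → All (_≺ m) S′ → Descending S′ → All (_∈ S₀) (m ∷ S′) →
                     All (λ y → m ∙ y ∈² S′ ⊎ y ∈ B) (m ∷ S′) → All (⟨_⟩ G B) (m ∷ S′)
    spanned-by-new {m} {S′} {B} m≻S′ desc S⊆S₀@(m∈ ∷ _) old⊎new =
      descending-induction resp (m≻S′ ∷ desc) (All.zipWith step (S⊆S₀ , old⊎new))
      where
      step : ∀ {y} → y ∈ S₀ × (m ∙ y ∈² S′ ⊎ y ∈ B) →
             (∀ {z} → z ∈ m ∷ S′ → y ≺ z → ⟨_⟩ G B z) → ⟨_⟩ G B y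
      step (_ , inj₂ y∈B) _ = gen y∈B
      step {y} (y∈ , inj₁ my∈²) above =
        let a , b , a∈ , b∈ , my≈ab = ∈²⁻ my∈²
            a≺m = ≺-lookup m≻S′ a∈
            b≺m = ≺-lookup m≻S′ b∈
            y≺a = factor-≺ʳ (trans (S₀-comm y∈ m∈) my≈ab) b≺m
            y≺b = factor-≺ˡ my≈ab a≺m
        in resp (sym (y≈x\\z m y (a ∙ b) my≈ab))
                (mul (inv (above (here refl) (<-trans y≺a a≺m)))
                     (mul (above (there a∈) y≺a) (above (there b∈) y≺b)))

    extend : ∀ {m S′} → All (_≺ m) S′ → Descending S′ → All (_∈ S₀) (m ∷ S′) →
             Generation S′ → Generation (m ∷ S′)
    extend {m} {S′} m≻S′ desc S⊆S₀@(m∈ ∷ S′⊆S₀) IH = grow (length-reject old?)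
      where
      open Generation IH

      old? : All (λ y → Dec (m ∙ y ∈² S′)) (m ∷ S′)
      old? = All.map (λ y∈ → ∈²? m∈ y∈ S′⊆S₀) S⊆S₀

      B : List Carrier
      B = reject old?

      B⊆S : All (_∈ m ∷ S′) B
      B⊆S = reject-All old? (All.tabulateₛ setoid id)

      new : List Carrier
      new = map (m ∙_) B

      new-unique : Unique new
      new-unique = Unique.map⁺ setoid setoid (∙-cancelˡ m _ _)
                     (reject-AllPairs old? (descending⇒unique (m≻S′ ∷ desc)))

      ¬old-resp : (λ y → ¬ m ∙ y ∈² S′) Respects _≈_
      ¬old-resp y≈y′ ¬my∈² my′∈² = ¬my∈² (∈²-resp-≈ (∙-congˡ (sym y≈y′)) my′∈²)

      new∉square : ∀ {z} → ¬ (z ∈ new × z ∈ square)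
      new∉square (z∈new , z∈square) =
        let y , y∈B , z≈my = ∈-map⁻ setoid setoid z∈new
        in All.lookupₛ setoid ¬old-resp (reject-¬ old?) y∈B
             (∈²-resp-≈ z≈my (All.lookupₛ setoid ∈²-resp-≈ square⊆S² z∈square))

      generatedBy : ∀ T → All (_∈ m ∷ S′) T → All (⟨_⟩ G T) (m ∷ S′) →
                    minSum (suc (length S′)) (length T) ≤ length B + minSum (length S′) (length gens) →
                    Generation (m ∷ S′)
      generatedBy T T⊆S spans count = record
        { gens            = T
        ; gens⊆S          = T⊆S
        ; S⊆⟨gens⟩        = spans
        ; square          = new ++ square
        ; square-unique   = Unique.++⁺ setoid new-unique square-unique new∉square
        ; square⊆S²       = All.++⁺ (All.map⁺ (All.map (λ y∈ → ∈²⁺ (here refl) y∈ refl) B⊆S))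
                                    (All.map ∈²-∷ square⊆S²)
        ; minSum≤|square| = begin
            minSum (suc (length S′)) (length T)        ≤⟨ count ⟩
            length B + minSum (length S′) (length gens) ≤⟨ +-monoʳ-≤ (length B) minSum≤|square| ⟩
            length B + length square                    ≡⟨ ≡.cong (_+ length square) (≡.sym (length-map _ B)) ⟩
            length new + length square                  ≡⟨ ≡.sym (length-++ new) ⟩
            length (new ++ square)                      ∎
        }
        where open ≤-Reasoning

      grow : length B ≡ length (m ∷ S′) ⊎ Any (λ y → m ∙ y ∈² S′) (m ∷ S′) →
             Generation (m ∷ S′)
      grow (inj₁ |B|≡|S|) =
        generatedBy (m ∷ gens) (here refl ∷ All.map there gens⊆S)
          (gen (here refl) ∷ All.map ⟨⟩-∷ S⊆⟨gens⟩)
          (≤-reflexive (≡.trans (minSum-suc-suc (length S′) (length gens)) (≡.cong (_+ _) (≡.sym |B|≡|S|))))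
      grow (inj₂ (here mm∈²)) = ⊥-elim (∙-self-∉² m≻S′ mm∈²)
      grow (inj₂ (there old)) with length gens ≤? length B
      ... | yes |gens|≤|B| =
        generatedBy gens (All.map there gens⊆S) (⟨⟩-least S⊆⟨gens⟩ (∙∈²⇒∈⟨⟩ old) ∷ S⊆⟨gens⟩)
          (minSum-step-≤ (length S′) ≤-refl |gens|≤|B|)
      ... | no |gens|≰|B| =
        generatedBy B B⊆S (spanned-by-new m≻S′ desc S⊆S₀ (reject-∈⊎ setoid old?))
          (minSum-step-≤ (length S′) (≰⇒≥ |gens|≰|B|) ≤-refl)

    generation : ∀ {S} → Descending S → All (_∈ S₀) S → Generation S
    generation {[]}     []            []                  = record
      { gens = [] ; gens⊆S = [] ; S⊆⟨gens⟩ = [] ; square = [] ; square-unique = [] ; square⊆S² = []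
      ; minSum≤|square| = z≤n }
    generation {m ∷ S′} (m≻S′ ∷ desc) S⊆S₀@(_ ∷ S′⊆S₀) =
      extend m≻S′ desc S⊆S₀ (generation desc S′⊆S₀)

    unique⇒generation : Unique S₀ → Generation S₀
    unique⇒generation S₀! = record
      { gens            = gens
      ; gens⊆S          = All.map (∈-resp-↭ sort↭S₀) gens⊆S
      ; S⊆⟨gens⟩        = All-resp-↭ resp sort↭S₀ S⊆⟨gens⟩
      ; square          = square
      ; square-unique   = square-unique
      ; square⊆S²       = All.map (∈²-resp-↭ sort↭S₀) square⊆S²
      ; minSum≤|square| = ≡.subst (λ k → minSum k (length gens) ≤ length square)
                                  (xs↭ys⇒|xs|≡|ys| sort↭S₀) minSum≤|square|
      }
      where
      sort↭S₀ : sort S₀ ↭ S₀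
      sort↭S₀ = sort-↭ S₀

      sorted : Generation (sort S₀)
      sorted = generation (sort-descending S₀!) (All.tabulateₛ setoid (∈-resp-↭ sort↭S₀))
      open Generation sorted

-- The bound holds for every c.
theorem2p3 : ∀ {a ℓ ℓ₂ : Level} (c : ℕ) → 2 ≤ c →
    (G : Group a ℓ) → Orderable G ℓ₂ →
    (S : List (Group.Carrier G)) → Uniqueₛ G S → GeneratedAbelian G S →
    (S² : List (Group.Carrier G)) → EnumeratesSquare G S S² →
    2 * length S² + c * (c + 1) < 2 * ((c + 1) * length S) →
    ∃ λ (T : List (Group.Carrier G)) → length T ≤ c × SameSubgroup G S T
theorem2p3 c _ G (_ , ord) S S! S-abelian S² (S²! , _ , S²-closed) few-products =
  gens , |gens|≤c , (λ _ → ⟨⟩-least S⊆⟨gens⟩) , (λ _ → ⟨⟩-least (All.map gen gens⊆S))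
  where
  open Group G
  open Membership setoid using (_∈_)
  open Squares G
  open Generations G ord

  S-comm : ∀ {x y} → x ∈ S → y ∈ S → x ∙ y ≈ y ∙ x
  S-comm x∈ y∈ = S-abelian _ _ (gen x∈) (gen y∈)

  S-∙-≟ : ∀ {x y u v} → x ∈ S → y ∈ S → u ∈ S → v ∈ S → Dec (x ∙ y ≈ u ∙ v)
  S-∙-≟ x∈ y∈ u∈ v∈ = unique⇒≈-dec setoid S²! (S²-closed _ _ x∈ y∈) (S²-closed _ _ u∈ v∈)

  open Generation (unique⇒generation S S-comm S-∙-≟ S!)

  ∈²⇒∈S² : ∀ {z} → z ∈² S → z ∈ S²
  ∈²⇒∈S² z∈² = let x , y , x∈ , y∈ , z≈xy = ∈²⁻ z∈² in
    MembershipProperties.∈-resp-≈ setoid (sym z≈xy) (S²-closed x y x∈ y∈)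

  |gens|≤c : length gens ≤ c
  |gens|≤c = minSum≤⇒≤ c (≤-trans minSum≤|square| (unique-⊆⇒length-≤ setoid square-unique
                                                      (All.map ∈²⇒∈S² square⊆S²))) few-products
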